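{- Let $G=(K\cup I,E)$ be a split graph such that no vertex $i\in I$ satisfies $N(i)=K$, and let $(V,\mathcal{F})$ be the split graph shelling antimatroid built on $G$. Then the number of paths of $(V,\mathcal{F})$ equals $|V|$ plus the number of edges of $G$ having one endpoint in $K$ and the other in $I$.
   Context: All graphs are finite and simple. A split graph $G=(K\cup I,E)$ has vertex set $V=K\cup I$ partitioned into a clique $K$ and an independent set $I$ (either may be empty), the partition being given. $N(v)$ is the set of neighbours of $v$. A vertex is simplicial if its neighbours induce a clique. The split graph vertex shelling antimatroid $(V,\mathcal{F})$ on $G$: $F\subseteq V$ is feasible iff there is an ordering $(f_1,\dots,f_{|F|})$ of $F$ such that each $f_j$ is simplicial in $G\setminus\{f_1,\dots,f_{j-1}\}$. A path of an antimatroid is a feasible set that cannot be written as the union of two feasible sets both different from it. -}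

module Defs where

open import Data.Nat using (ℕ; _+_)
open import Data.Bool using (Bool; true; false; if_then_else_; _∧_; not)
open import Data.Fin using (Fin)
open import Data.Fin.Subset using (Subset; _∈_; _∪_; ⊥)
open import Data.Nat.ListAction using (sum)
open import Data.List using (List; []; _∷_; map; cartesianProduct; allFin; length)
import Data.List.Membership.Propositional as LM
open import Data.List.Relation.Unary.Unique.Propositional using (Unique)
open import Data.Product using (Σ; _×_; _,_; ∃; ∃-syntax)
open import Data.Unit using (⊤)
open import Function.Bundles using (_⇔_)
open import Relation.Binary.PropositionalEquality using (_≡_; _≢_)
open import Relation.Nullary using (¬_)

-- A finite simple graph on vertex set Fin n together with a given split
-- partition V = K ∪ I (inK v = true means v ∈ K, false means v ∈ I).
record SplitGraph (n : ℕ) : Set where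
  field
    adj    : Fin n → Fin n → Bool
    adj-sym : ∀ u v → adj u v ≡ adj v u
    adj-irrefl : ∀ v → adj v v ≡ false
    inK    : Fin n → Bool
    K-clique : ∀ u v → inK u ≡ true → inK v ≡ true → u ≢ v → adj u v ≡ true
    I-indep  : ∀ u v → inK u ≡ false → inK v ≡ false → adj u v ≡ false

module _ {n : ℕ} (G : SplitGraph n) where
  open SplitGraph G

  -- v is simplicial in G ∖ R (R = list of already removed vertices):
  -- v is still present and its remaining neighbours are pairwise adjacent.
  Simplicial : List (Fin n) → Fin n → Set
  Simplicial R v =
    ¬ (v LM.∈ R) ×
    (∀ u w → ¬ (u LM.∈ R) → ¬ (w LM.∈ R) →
       adj v u ≡ true → adj v w ≡ true → u ≢ w → adj u w ≡ true)

  Valid : List (Fin n) → List (Fin n) → Set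
  Valid R []       = ⊤
  Valid R (f ∷ fs) = Simplicial R f × Valid (f ∷ R) fs

  Feasible : Subset n → Set
  Feasible F = ∃[ fs ] (Valid [] fs × (∀ x → (x ∈ F) ⇔ (x LM.∈ fs)))

  IsPath : Subset n → Set
  IsPath F = Feasible F × F ≢ ⊥ ×
    ¬ (∃[ A ] ∃[ B ] (Feasible A × Feasible B × A ≢ F × B ≢ F × (A ∪ B) ≡ F))

  -- number of edges with one endpoint in K and the other in I
  -- (each such edge counted once, as the ordered pair (k , i) with k ∈ K, i ∈ I).
  crossEdges : ℕ
  crossEdges = sum (map (λ p → indicator (Data.Product.proj₁ p) (Data.Product.proj₂ p))
                        (cartesianProduct (allFin n) (allFin n)))
    where
      indicator : Fin n → Fin n → ℕ
      indicator k i = if inK k ∧ not (inK i) ∧ adj k i then 1 else 0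

  NumPathsIs : ℕ → Set
  NumPathsIs c = ∃[ ps ] (Unique ps × (∀ F → (F LM.∈ ps) ⇔ IsPath F) × length ps ≡ c)

module Submission where

-- For a vertex x let  A_x = {x} ∪ (N(x) ∩ I).  For a cross edge xi (x ∈ K,
-- i ∈ I) let  T_i = K ∖ N(i)  and let  B_xi = {x} ∪ T_i ∪ {z ∈ I ∖ {i} :
-- z ∈ N(x) or z ∈ N(t) for some t ∈ T_i}.  Call these the rooted sets, with
-- root x.  We show that the paths are exactly the rooted sets and that
-- distinct tags (x, resp. x and i) give distinct sets; counting the tags
-- gives n + |E(K, I)|.
--
-- Then three facts
-- about rooted sets: (1) they are feasible; (2) covering: if x is simplicial
-- after a shelling word w, some rooted set with root x lies inside w ∪ {x};
-- (3) rooted sets with the same root are ⊆-incomparable (here N(i) ≠ K is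
-- used: it makes T_i nonempty).  From these, a rooted set is the only
-- feasible subset of itself containing its root, which makes it a path, makes
-- its root the last letter of each of its shelling words (so the enumeration
-- is injective), and decomposes every path F = C ∪ F' with C rooted and F'
-- feasible not containing the last vertex of F, forcing F = C.

open import Defs
open import Data.Nat using (ℕ; suc; _+_)
open import Data.Nat.ListAction using (sum)
open import Data.Bool using (Bool; true; false; _∧_; not; if_then_else_; T)
open import Data.Bool.Properties using (not-¬; ¬-not; T?) renaming (_≟_ to _≟B_)
open import Data.Empty using (⊥-elim) renaming (⊥ to Empty)
open import Data.Fin using (Fin) renaming (_≟_ to _≟F_)
open import Data.Fin.Properties using (any?)
open import Data.Fin.Subset using (Subset; _⊆_; _∪_) renaming (_∈_ to _∈ₛ_; ⊥ to ∅)
open import Data.Fin.Subset.Properties using (⊆-antisym; ∉⊥; x∈p∪q⁻; x∈p∪q⁺)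
open import Data.List using (List; []; _∷_; _++_; _∷ʳ_; _ʳ++_; map; filter; allFin; length; cartesianProduct; initLast; _∷ʳ′_)
open import Data.List.Properties using (length-++; length-map; length-tabulate)
open import Data.List.Membership.Propositional using () renaming (_∈_ to _∈L_)
open import Data.List.Membership.Propositional.Properties using (∈-filter⁺; ∈-filter⁻; ∈-allFin; ∈-++⁺ˡ; ∈-++⁺ʳ; ∈-++⁻; ∈-map⁺; ∈-map⁻; ∈-∃++; ∈-cartesianProduct⁺)
open import Data.List.Relation.Unary.Any using (here; there)
open import Data.List.Relation.Unary.Any.Properties using (reverseAcc⁺; reverseAcc⁻)
import Data.List.Relation.Unary.All as All
import Data.List.Relation.Unary.All.Properties as AllP
open import Data.List.Relation.Unary.AllPairs using ([]; _∷_)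
open import Data.List.Relation.Unary.Unique.Propositional using (Unique)
open import Data.List.Relation.Unary.Unique.Propositional.Properties using (++⁺; filter⁺; cartesianProduct⁺; allFin⁺) renaming (map⁺ to map-Unique⁺)
open import Data.Maybe using (Maybe; just; nothing)
open import Data.Product using (_×_; _,_; ∃-syntax; proj₁; proj₂; map₁; map₂)
open import Data.Sum using (_⊎_; inj₁; inj₂)
open import Data.Unit using (⊤; tt)
open import Data.Vec using (tabulate)
open import Data.Vec.Properties using (lookup∘tabulate; lookup⇒[]=; []=⇒lookup; ≡-dec)
open import Function using (_∘_; id)
open import Function.Bundles using (_⇔_; mk⇔; Equivalence)
open import Relation.Binary.PropositionalEquality using (_≡_; _≢_; refl; sym; trans; cong; cong₂; subst; module ≡-Reasoning)
open import Relation.Nullary using (¬_; yes; no; does)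
open import Relation.Nullary.Decidable using (_×-dec_; _⊎-dec_; ¬?; dec-true; decidable-stable)
open import Relation.Unary using (Decidable)

open Equivalence using (to; from)

true≢false : ∀ {b : Bool} → b ≡ true → b ≡ false → Empty
true≢false b≡true = not-¬ b≡true

≢false⇒true : ∀ {b : Bool} → b ≢ false → b ≡ true
≢false⇒true = ¬-not

length-filter-T : ∀ {A : Set} (b : A → Bool) (xs : List A) →
  length (filter (λ x → T? (b x)) xs) ≡ sum (map (λ x → if b x then 1 else 0) xs)
length-filter-T b [] = refl
length-filter-T b (x ∷ xs) with b x
... | true  = cong suc (length-filter-T b xs)
... | false = length-filter-T b xs

Unique-map⁺ : ∀ {A B : Set} (f : A → B) {xs : List A} →
  (∀ {a b} → a ∈L xs → b ∈L xs → f a ≡ f b → a ≡ b) → Unique xs → Unique (map f xs)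
Unique-map⁺ f {[]} _ [] = []
Unique-map⁺ f {x ∷ xs} inj (x∉xs ∷ xs-unique) =
  AllP.map⁺ (All.tabulate (λ y∈xs fx≡fy → All.lookup x∉xs y∈xs (inj (here refl) (there y∈xs) fx≡fy)))
  ∷ Unique-map⁺ f (λ a∈xs b∈xs → inj (there a∈xs) (there b∈xs)) xs-unique

module _ {A : Set} where
  ∈-ʳ++⁻ : ∀ w R {z : A} → z ∈L w ʳ++ R → z ∈L R ⊎ z ∈L w
  ∈-ʳ++⁻ w R = reverseAcc⁻ R w

  ∈-ʳ++⁺ˡ : ∀ w {R} {z : A} → z ∈L R → z ∈L w ʳ++ R
  ∈-ʳ++⁺ˡ w {R} z∈R = reverseAcc⁺ R w (inj₁ z∈R)

  ∈-ʳ++⁺ʳ : ∀ w {R} {z : A} → z ∈L w → z ∈L w ʳ++ R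
  ∈-ʳ++⁺ʳ w {R} z∈w = reverseAcc⁺ R w (inj₂ z∈w)

  ∈-ʳ++[]⁻ : ∀ w {z : A} → z ∈L w ʳ++ [] → z ∈L w
  ∈-ʳ++[]⁻ w z∈ with ∈-ʳ++⁻ w [] z∈
  ... | inj₂ z∈w = z∈w

  ∈-∷ʳ⁺ : ∀ w {x z : A} → z ∈L w ⊎ z ≡ x → z ∈L w ∷ʳ x
  ∈-∷ʳ⁺ w (inj₁ z∈w) = ∈-++⁺ˡ z∈w
  ∈-∷ʳ⁺ w (inj₂ z≡x) = ∈-++⁺ʳ w (here z≡x)

  ∈-∷ʳ⁻ : ∀ w {x z : A} → z ∈L w ∷ʳ x → z ∈L w ⊎ z ≡ x
  ∈-∷ʳ⁻ w z∈ with ∈-++⁻ w z∈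
  ... | inj₁ z∈w        = inj₁ z∈w
  ... | inj₂ (here z≡x) = inj₂ z≡x

module _ {n : ℕ} where
  open import Data.List.Membership.DecPropositional (_≟F_ {n}) using (_∈?_) public

  subsetOf : {P : Fin n → Set} → Decidable P → Subset n
  subsetOf P? = tabulate (λ z → does (P? z))

  ∈-subsetOf⁺ : ∀ {P : Fin n → Set} (P? : Decidable P) {z} → P z → z ∈ₛ subsetOf P?
  ∈-subsetOf⁺ P? {z} pz = lookup⇒[]= z _ (trans (lookup∘tabulate _ z) (dec-true (P? z) pz))

  ∈-subsetOf⁻ : ∀ {P : Fin n → Set} (P? : Decidable P) {z} → z ∈ₛ subsetOf P? → P z
  ∈-subsetOf⁻ P? {z} z∈ with P? z | trans (sym (lookup∘tabulate _ z)) ([]=⇒lookup z∈)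
  ... | yes pz | _ = pz

  letters : List (Fin n) → Subset n
  letters w = subsetOf (_∈? w)

  enum : {P : Fin n → Set} → Decidable P → List (Fin n)
  enum P? = filter P? (allFin n)

  ∈-enum⁺ : ∀ {P : Fin n → Set} (P? : Decidable P) {z} → P z → z ∈L enum P?
  ∈-enum⁺ P? {z} pz = ∈-filter⁺ P? (∈-allFin z) pz

  ∈-enum⁻ : ∀ {P : Fin n → Set} (P? : Decidable P) {z} → z ∈L enum P? → P z
  ∈-enum⁻ P? z∈ = proj₂ (∈-filter⁻ P? {xs = allFin n} z∈)

  enum-Unique : ∀ {P : Fin n → Set} (P? : Decidable P) → Unique (enum P?)
  enum-Unique P? = filter⁺ P? (allFin⁺ n)

  listed-∪ : ∀ {F C : Subset n} {pre ℓ} → (∀ z → z ∈ₛ F ⇔ z ∈L pre ∷ʳ ℓ) →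
    C ⊆ F → ℓ ∈ₛ C → C ∪ letters pre ≡ F
  listed-∪ {F} {C} {pre} {ℓ} listed C⊆F ℓ∈C = ⊆-antisym ∪⊆F F⊆∪
    where
    ∪⊆F : C ∪ letters pre ⊆ F
    ∪⊆F {z} z∈ with x∈p∪q⁻ C (letters pre) z∈
    ... | inj₁ z∈C   = C⊆F z∈C
    ... | inj₂ z∈pre = from (listed z) (∈-∷ʳ⁺ pre (inj₁ (∈-subsetOf⁻ (_∈? pre) z∈pre)))
    F⊆∪ : F ⊆ C ∪ letters pre
    F⊆∪ {z} z∈F with ∈-∷ʳ⁻ pre (to (listed z) z∈F)
    ... | inj₁ z∈pre = x∈p∪q⁺ (inj₂ (∈-subsetOf⁺ (_∈? pre) z∈pre))
    ... | inj₂ refl  = x∈p∪q⁺ (inj₁ ℓ∈C)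

-- Shelling words of a fixed split graph G.  After shelling the word w from
-- G ∖ R, the removed vertices are those of  w ʳ++ R.
module Shelling {n : ℕ} (G : SplitGraph n) where
  open SplitGraph G

  K≢I : ∀ {u v} → inK u ≡ true → inK v ≡ false → u ≢ v
  K≢I u∈K v∈I refl = true≢false u∈K v∈I

  I-no-I-neighbour : ∀ {z u} → inK z ≡ false → adj z u ≡ true → inK u ≡ false → Empty
  I-no-I-neighbour {z} {u} z∈I azu u∈I = true≢false azu (I-indep z u z∈I u∈I)

  Valid-++⁺ : ∀ R xs {ys} → Valid G R xs → Valid G (xs ʳ++ R) ys → Valid G R (xs ++ ys)
  Valid-++⁺ R []       _            valid-ys = valid-ys
  Valid-++⁺ R (x ∷ xs) (sx , vxs) valid-ys = sx , Valid-++⁺ (x ∷ R) xs vxs valid-ys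

  Valid-++⁻ : ∀ R xs {ys} → Valid G R (xs ++ ys) → Valid G R xs × Valid G (xs ʳ++ R) ys
  Valid-++⁻ R []       valid        = tt , valid
  Valid-++⁻ R (x ∷ xs) (sx , valid) = map₁ (sx ,_) (Valid-++⁻ (x ∷ R) xs valid)

  lastLetter : ∀ pre {ℓ} → Valid G [] (pre ∷ʳ ℓ) → Valid G [] pre × Simplicial G (pre ʳ++ []) ℓ
  lastLetter pre valid = map₂ proj₁ (Valid-++⁻ [] pre valid)

  simplicial-at : ∀ {w x} → Valid G [] w → x ∈L w →
    ∃[ pre ] (Valid G [] pre × Simplicial G (pre ʳ++ []) x × (∀ {z} → z ∈L pre ∷ʳ x → z ∈L w))
  simplicial-at {w} {x} valid x∈w with ∈-∃++ x∈w
  ... | pre , suf , refl with Valid-++⁻ [] pre valid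
  ...   | valid-pre , (sx , _) = pre , valid-pre , sx , inPrefix
    where
    inPrefix : ∀ {z} → z ∈L pre ∷ʳ x → z ∈L pre ++ x ∷ suf
    inPrefix z∈ with ∈-∷ʳ⁻ pre z∈
    ... | inj₁ z∈pre = ∈-++⁺ˡ z∈pre
    ... | inj₂ z≡x   = ∈-++⁺ʳ pre (here z≡x)

  -- A present vertex all of whose I-neighbours are removed is simplicial:
  -- its remaining neighbours lie in the clique K.
  simplicial-if-I-removed : ∀ R v → ¬ v ∈L R →
    (∀ u → adj v u ≡ true → inK u ≡ false → u ∈L R) → Simplicial G R v
  simplicial-if-I-removed R v v∉R I-removed =
    v∉R , λ u w u∉R w∉R avu avw u≢w → K-clique u w (inK-left u u∉R avu) (inK-left w w∉R avw) u≢w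
    where
    inK-left : ∀ u → ¬ u ∈L R → adj v u ≡ true → inK u ≡ true
    inK-left u u∉R avu = ≢false⇒true (λ u∈I → u∉R (I-removed u avu u∈I))

  valid-if-I-removed : ∀ R w → Unique w → (∀ {z} → z ∈L w → ¬ z ∈L R) →
    (∀ {z} → z ∈L w → ∀ u → adj z u ≡ true → inK u ≡ false → u ∈L R) → Valid G R w
  valid-if-I-removed R []       _                  _        _         = tt
  valid-if-I-removed R (f ∷ fs) (f∉fs ∷ fs-unique) disjoint I-removed =
    simplicial-if-I-removed R f (disjoint (here refl)) (I-removed (here refl)) ,
    valid-if-I-removed (f ∷ R) fs fs-unique disjoint′ (λ z∈fs u azu u∈I → there (I-removed (there z∈fs) u azu u∈I))
    where
    disjoint′ : ∀ {z} → z ∈L fs → ¬ z ∈L f ∷ R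
    disjoint′ z∈fs (here z≡f)  = All.lookup f∉fs z∈fs (sym z≡f)
    disjoint′ z∈fs (there z∈R) = disjoint (there z∈fs) z∈R

  feasible-listed : ∀ {P : Fin n → Set} (P? : Decidable P) w → Valid G [] w →
    (∀ {z} → P z → z ∈L w) → (∀ {z} → z ∈L w → P z) → Feasible G (subsetOf P?)
  feasible-listed P? w valid P⇒∈ ∈⇒P =
    w , valid , λ z → mk⇔ (P⇒∈ ∘ ∈-subsetOf⁻ P?) (∈-subsetOf⁺ P? ∘ ∈⇒P)

  feasible-letters : ∀ {w} → Valid G [] w → Feasible G (letters w)
  feasible-letters {w} valid = feasible-listed (_∈? w) w valid id id

  -- Ingredients of the rooted sets: I-neighbours of x, the set T_i, and the
  -- I-vertices of B_xi.
  INbr : Fin n → Fin n → Set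
  INbr x z = inK z ≡ false × adj x z ≡ true

  INbr? : ∀ x → Decidable (INbr x)
  INbr? x z = (inK z ≟B false) ×-dec (adj x z ≟B true)

  NonNbr : Fin n → Fin n → Set
  NonNbr i z = inK z ≡ true × adj i z ≡ false

  NonNbr? : ∀ i → Decidable (NonNbr i)
  NonNbr? i z = (inK z ≟B true) ×-dec (adj i z ≟B false)

  BI : Fin n → Fin n → Fin n → Set
  BI x i z = inK z ≡ false × ((adj x z ≡ true × z ≢ i) ⊎ ∃[ t ] (NonNbr i t × adj t z ≡ true))

  BI? : ∀ x i → Decidable (BI x i)
  BI? x i z = (inK z ≟B false) ×-dec
    (((adj x z ≟B true) ×-dec ¬? (z ≟F i)) ⊎-dec any? (λ t → NonNbr? i t ×-dec (adj t z ≟B true)))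

  -- Tags: (x , nothing) names A_x and (x , just i) names B_xi; x is the root.
  Tag : Set
  Tag = Fin n × Maybe (Fin n)

  root : Tag → Fin n
  root = proj₁

  CrossEdge : Fin n → Fin n → Set
  CrossEdge x i = inK x ≡ true × inK i ≡ false × adj x i ≡ true

  ValidTag : Tag → Set
  ValidTag (x , nothing) = ⊤
  ValidTag (x , just i)  = CrossEdge x i

  InRooted : Tag → Fin n → Set
  InRooted (x , nothing) z = z ≡ x ⊎ INbr x z
  InRooted (x , just i)  z = z ≡ x ⊎ NonNbr i z ⊎ BI x i z

  InRooted? : ∀ t → Decidable (InRooted t)
  InRooted? (x , nothing) z = (z ≟F x) ⊎-dec INbr? x z
  InRooted? (x , just i)  z = (z ≟F x) ⊎-dec (NonNbr? i z ⊎-dec BI? x i z)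

  rooted : Tag → Subset n
  rooted t = subsetOf (InRooted? t)

  root∈rooted : ∀ t → root t ∈ₛ rooted t
  root∈rooted t = ∈-subsetOf⁺ (InRooted? t) (root-in t)
    where
    root-in : ∀ t → InRooted t (root t)
    root-in (x , nothing) = inj₁ refl
    root-in (x , just i)  = inj₁ refl

  -- (1) A_x is feasible: first remove the I-neighbours of x (they have no
  -- I-neighbours), then x, whose remaining neighbours lie in K.
  feasible-A : ∀ x → Feasible G (rooted (x , nothing))
  feasible-A x = feasible-listed (InRooted? (x , nothing)) (L ∷ʳ x) valid A⇒∈ ∈⇒A
    where
    L = enum (INbr? x)
    valid-L : Valid G [] L
    valid-L = valid-if-I-removed [] L (enum-Unique _) (λ _ ())
      (λ z∈L u azu u∈I → ⊥-elim (I-no-I-neighbour (proj₁ (∈-enum⁻ _ z∈L)) azu u∈I))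
    x∉L : ¬ x ∈L L ʳ++ []
    x∉L x∈ = true≢false (proj₂ (∈-enum⁻ _ (∈-ʳ++[]⁻ L x∈))) (adj-irrefl x)
    valid : Valid G [] (L ∷ʳ x)
    valid = Valid-++⁺ [] L valid-L
      (simplicial-if-I-removed _ x x∉L (λ u axu u∈I → ∈-ʳ++⁺ʳ L (∈-enum⁺ _ (u∈I , axu))) , tt)
    A⇒∈ : ∀ {z} → InRooted (x , nothing) z → z ∈L L ∷ʳ x
    A⇒∈ (inj₁ z≡x)  = ∈-∷ʳ⁺ L (inj₂ z≡x)
    A⇒∈ (inj₂ xz)   = ∈-∷ʳ⁺ L (inj₁ (∈-enum⁺ _ xz))
    ∈⇒A : ∀ {z} → z ∈L L ∷ʳ x → InRooted (x , nothing) z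
    ∈⇒A z∈ with ∈-∷ʳ⁻ L z∈
    ... | inj₁ z∈L = inj₂ (∈-enum⁻ _ z∈L)
    ... | inj₂ z≡x = inj₁ z≡x

  -- (1) B_xi is feasible: remove its I-vertices, then T_i (whose I-neighbours
  -- are now gone), then x, whose remaining neighbours are i and N(i) ∩ K.
  feasible-B : ∀ {x i} → CrossEdge x i → Feasible G (rooted (x , just i))
  feasible-B {x} {i} (x∈K , i∈I , axi) =
    feasible-listed (InRooted? (x , just i)) (L₁ ++ L₂ ∷ʳ x) valid B⇒∈ ∈⇒B
    where
    L₁ = enum (BI? x i)
    L₂ = enum (NonNbr? i)
    R = L₂ ʳ++ L₁ ʳ++ []
    valid-L₁ : Valid G [] L₁
    valid-L₁ = valid-if-I-removed [] L₁ (enum-Unique _) (λ _ ())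
      (λ z∈L₁ u azu u∈I → ⊥-elim (I-no-I-neighbour (proj₁ (∈-enum⁻ _ z∈L₁)) azu u∈I))
    valid-L₂ : Valid G (L₁ ʳ++ []) L₂
    valid-L₂ = valid-if-I-removed _ L₂ (enum-Unique _)
      (λ z∈L₂ z∈L₁ → true≢false (proj₁ (∈-enum⁻ _ z∈L₂)) (proj₁ (∈-enum⁻ _ (∈-ʳ++[]⁻ L₁ z∈L₁))))
      (λ {t} t∈L₂ u atu u∈I → ∈-ʳ++⁺ʳ L₁ (∈-enum⁺ _ (u∈I , inj₂ (t , ∈-enum⁻ _ t∈L₂ , atu))))
    removed⁻ : ∀ {z} → z ∈L R → z ∈L L₁ ⊎ z ∈L L₂
    removed⁻ z∈ with ∈-ʳ++⁻ L₂ _ z∈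
    ... | inj₁ z∈L₁ = inj₁ (∈-ʳ++[]⁻ L₁ z∈L₁)
    ... | inj₂ z∈L₂ = inj₂ z∈L₂
    x∉R : ¬ x ∈L R
    x∉R x∈ with removed⁻ x∈
    ... | inj₁ x∈L₁ = true≢false x∈K (proj₁ (∈-enum⁻ _ x∈L₁))
    ... | inj₂ x∈L₂ = true≢false (trans (adj-sym i x) axi) (proj₂ (∈-enum⁻ _ x∈L₂))
    remaining : ∀ v → ¬ v ∈L R → adj x v ≡ true → (inK v ≡ true × adj i v ≡ true) ⊎ v ≡ i
    remaining v v∉R axv with inK v in v-side | v ≟F i
    ... | true  | _ = inj₁ (refl , ≢false⇒true (λ aiv → v∉R (∈-ʳ++⁺ʳ L₂ (∈-enum⁺ _ (v-side , aiv)))))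
    ... | false | yes v≡i = inj₂ v≡i
    ... | false | no v≢i  = ⊥-elim (v∉R (∈-ʳ++⁺ˡ L₂ (∈-ʳ++⁺ʳ L₁ (∈-enum⁺ _ (v-side , inj₁ (axv , v≢i))))))
    cliqueNbrs : ∀ u v → ¬ u ∈L R → ¬ v ∈L R → adj x u ≡ true → adj x v ≡ true → u ≢ v → adj u v ≡ true
    cliqueNbrs u v u∉R v∉R axu axv u≢v with remaining u u∉R axu | remaining v v∉R axv
    ... | inj₁ (u∈K , _)   | inj₁ (v∈K , _)   = K-clique u v u∈K v∈K u≢v
    ... | inj₁ (_ , aiu)   | inj₂ refl        = trans (adj-sym u i) aiu
    ... | inj₂ refl        | inj₁ (_ , aiv)   = aiv
    ... | inj₂ refl        | inj₂ refl        = ⊥-elim (u≢v refl)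
    valid : Valid G [] (L₁ ++ L₂ ∷ʳ x)
    valid = Valid-++⁺ [] L₁ valid-L₁ (Valid-++⁺ _ L₂ valid-L₂ ((x∉R , cliqueNbrs) , tt))
    B⇒∈ : ∀ {z} → InRooted (x , just i) z → z ∈L L₁ ++ L₂ ∷ʳ x
    B⇒∈ (inj₁ z≡x)        = ∈-++⁺ʳ L₁ (∈-∷ʳ⁺ L₂ (inj₂ z≡x))
    B⇒∈ (inj₂ (inj₁ iz)) = ∈-++⁺ʳ L₁ (∈-∷ʳ⁺ L₂ (inj₁ (∈-enum⁺ _ iz)))
    B⇒∈ (inj₂ (inj₂ bz)) = ∈-++⁺ˡ (∈-enum⁺ _ bz)
    ∈⇒B : ∀ {z} → z ∈L L₁ ++ L₂ ∷ʳ x → InRooted (x , just i) z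
    ∈⇒B z∈ with ∈-++⁻ L₁ z∈
    ... | inj₁ z∈L₁ = inj₂ (inj₂ (∈-enum⁻ _ z∈L₁))
    ... | inj₂ z∈′ with ∈-∷ʳ⁻ L₂ z∈′
    ...   | inj₁ z∈L₂ = inj₂ (inj₁ (∈-enum⁻ _ z∈L₂))
    ...   | inj₂ z≡x  = inj₁ z≡x

  feasible-rooted : ∀ {t} → ValidTag t → Feasible G (rooted t)
  feasible-rooted {x , nothing} _  = feasible-A x
  feasible-rooted {x , just i}  xi = feasible-B xi

  cover-edge : ∀ {w x i} → Valid G [] w → Simplicial G (w ʳ++ []) x → INbr x i → ¬ i ∈L w →
    CrossEdge x i × (∀ {z} → InRooted (x , just i) z → z ∈L w ∷ʳ x)
  cover-edge {w} {x} {i} valid (x∉w′ , x-simplicial) (i∈I , axi) i∉w = (x∈K , i∈I , axi) , B⊆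
    where
    x∈K : inK x ≡ true
    x∈K = ≢false⇒true (λ x∈I → I-no-I-neighbour x∈I axi i∈I)
    aix : adj i x ≡ true
    aix = trans (adj-sym i x) axi
    x∉w : ¬ x ∈L w
    x∉w = x∉w′ ∘ ∈-ʳ++⁺ʳ w
    adjacent : ∀ {u v} → ¬ u ∈L w → ¬ v ∈L w → adj x u ≡ true → adj x v ≡ true → u ≢ v → adj u v ≡ true
    adjacent u∉w v∉w = x-simplicial _ _ (u∉w ∘ ∈-ʳ++[]⁻ w) (v∉w ∘ ∈-ʳ++[]⁻ w)
    -- so i is the only I-neighbour of x surviving w ...
    otherINbr∈w : ∀ {j} → INbr x j → j ≢ i → j ∈L w
    otherINbr∈w {j} (j∈I , axj) j≢i = decidable-stable (j ∈? w)
      (λ j∉w → I-no-I-neighbour j∈I (adjacent j∉w i∉w axj axi j≢i) i∈I)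
    -- ... and T_i is removed by w, since its members are K-neighbours of x ...
    nonNbr∈w : ∀ {t} → NonNbr i t → t ∈L w
    nonNbr∈w {t} (t∈K , ait) = decidable-stable (t ∈? w)
      (λ t∉w → true≢false (adjacent i∉w t∉w axi (K-clique x t x∈K t∈K x≢t) (K≢I t∈K i∈I ∘ sym)) ait)
      where
      x≢t : x ≢ t
      x≢t refl = true≢false aix ait
    -- ... and an I-neighbour y of t ∈ T_i is removed by w: when t is removed,
    -- y and x are both its neighbours, so y is an I-neighbour of x.
    tailI∈w : ∀ {t y} → NonNbr i t → inK y ≡ false → adj t y ≡ true → y ∈L w
    tailI∈w {t} {y} (t∈K , ait) y∈I aty with simplicial-at valid (nonNbr∈w (t∈K , ait))
    ... | pre , _ , (_ , t-simplicial) , pre⊆w = decidable-stable (y ∈? w)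
      (λ y∉w → y∉w (otherINbr∈w (y∈I , axy y∉w) y≢i))
      where
      outside : ∀ {z} → ¬ z ∈L w → ¬ z ∈L pre ʳ++ []
      outside z∉w z∈ = z∉w (pre⊆w (∈-∷ʳ⁺ pre (inj₁ (∈-ʳ++[]⁻ pre z∈))))
      atx : adj t x ≡ true
      atx = K-clique t x t∈K x∈K (λ { refl → true≢false aix ait })
      axy : ¬ y ∈L w → adj x y ≡ true
      axy y∉w = trans (adj-sym x y)
        (t-simplicial y x (outside y∉w) (outside x∉w) aty atx (K≢I x∈K y∈I ∘ sym))
      y≢i : y ≢ i
      y≢i refl = true≢false (trans (adj-sym i t) aty) ait
    B⊆ : ∀ {z} → InRooted (x , just i) z → z ∈L w ∷ʳ x
    B⊆ (inj₁ z≡x)                              = ∈-∷ʳ⁺ w (inj₂ z≡x)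
    B⊆ (inj₂ (inj₁ tz))                        = ∈-∷ʳ⁺ w (inj₁ (nonNbr∈w tz))
    B⊆ (inj₂ (inj₂ (z∈I , inj₁ (axz , z≢i))))  = ∈-∷ʳ⁺ w (inj₁ (otherINbr∈w (z∈I , axz) z≢i))
    B⊆ (inj₂ (inj₂ (z∈I , inj₂ (t , tt′ , atz)))) = ∈-∷ʳ⁺ w (inj₁ (tailI∈w tt′ z∈I atz))

  -- (2) Covering: if x is simplicial after the shelling word w, some rooted
  -- set with root x lies in w ∪ {x} (A_x if w removes all I-neighbours of x).
  cover : ∀ {w x} → Valid G [] w → Simplicial G (w ʳ++ []) x →
    ∃[ t ] (ValidTag t × root t ≡ x × (∀ {z} → InRooted t z → z ∈L w ∷ʳ x))
  cover {w} {x} valid sx with any? (λ i → INbr? x i ×-dec ¬? (i ∈? w))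
  ... | yes (i , xi , i∉w) = (x , just i) , proj₁ edge , refl , proj₂ edge
    where edge = cover-edge valid sx xi i∉w
  ... | no none = (x , nothing) , tt , refl , A⊆
    where
    A⊆ : ∀ {z} → InRooted (x , nothing) z → z ∈L w ∷ʳ x
    A⊆ (inj₁ z≡x)     = ∈-∷ʳ⁺ w (inj₂ z≡x)
    A⊆ {z} (inj₂ xz) = ∈-∷ʳ⁺ w (inj₁ (decidable-stable (z ∈? w) (λ z∉w → none (z , xz , z∉w))))

  rooted-inside : ∀ {A x} → Feasible G A → x ∈ₛ A → ∃[ t ] (ValidTag t × root t ≡ x × rooted t ⊆ A)
  rooted-inside (w , valid , listed) x∈A with simplicial-at valid (to (listed _) x∈A)
  ... | pre , valid-pre , sx , pre⊆w with cover valid-pre sx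
  ...   | t , vt , rt , t⊆ = t , vt , rt , λ z∈ → from (listed _) (pre⊆w (t⊆ (∈-subsetOf⁻ (InRooted? t) z∈)))

  module Rooted (noUniversal : ∀ i → inK i ≡ false → ¬ (∀ v → (adj i v ≡ true) ⇔ (inK v ≡ true))) where

    nonNbr-exists : ∀ {i} → inK i ≡ false → ∃[ t ] NonNbr i t
    nonNbr-exists {i} i∈I with any? (NonNbr? i)
    ... | yes found = found
    ... | no none   = ⊥-elim (noUniversal i i∈I (λ v → mk⇔ (nbr⇒K v) (K⇒nbr v)))
      where
      nbr⇒K : ∀ v → adj i v ≡ true → inK v ≡ true
      nbr⇒K v aiv = ≢false⇒true (I-no-I-neighbour i∈I aiv)
      K⇒nbr : ∀ v → inK v ≡ true → adj i v ≡ true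
      K⇒nbr v v∈K = ≢false⇒true (λ aiv → none (v , v∈K , aiv))

    i∉B : ∀ {x i} → CrossEdge x i → ¬ InRooted (x , just i) i
    i∉B (x∈K , i∈I , _) (inj₁ refl)                          = true≢false x∈K i∈I
    i∉B (_ , i∈I , _)   (inj₂ (inj₁ (i∈K , _)))              = true≢false i∈K i∈I
    i∉B _               (inj₂ (inj₂ (_ , inj₁ (_ , i≢i))))   = i≢i refl
    i∉B {i = i} _       (inj₂ (inj₂ (_ , inj₂ (t , (_ , ait) , ati)))) = true≢false (trans (adj-sym i t) ati) ait

    -- (3) Rooted sets with a common root are ⊆-incomparable: i ∈ A_x ∖ B_xi,
    -- T_i ⊆ B_xi ∖ A_x, and j ∈ B_xi ∖ B_xj.
    incomparable : ∀ {t t′} → ValidTag t → ValidTag t′ → root t ≡ root t′ →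
      rooted t ⊆ rooted t′ → t ≡ t′
    incomparable {t} {t′} vt vt′ same-root t⊆t′ = by-cases vt vt′ same-root included
      where
      included : ∀ {z} → InRooted t z → InRooted t′ z
      included = ∈-subsetOf⁻ (InRooted? t′) ∘ t⊆t′ ∘ ∈-subsetOf⁺ (InRooted? t)
      by-cases : ∀ {t t′} → ValidTag t → ValidTag t′ → root t ≡ root t′ →
        (∀ {z} → InRooted t z → InRooted t′ z) → t ≡ t′
      by-cases {x , nothing} {.x , nothing} _ _ refl _ = refl
      by-cases {x , nothing} {.x , just i} _ xi@(_ , i∈I , axi) refl A⊆B =
        ⊥-elim (i∉B xi (A⊆B (inj₂ (i∈I , axi))))
      by-cases {x , just i} {.x , nothing} (_ , i∈I , axi) _ refl B⊆A with nonNbr-exists i∈I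
      ... | t , (t∈K , ait) with B⊆A (inj₂ (inj₁ (t∈K , ait)))
      ...   | inj₁ refl         = ⊥-elim (true≢false (trans (adj-sym i x) axi) ait)
      ...   | inj₂ (t∈I , _)    = ⊥-elim (true≢false t∈K t∈I)
      by-cases {x , just i} {.x , just j} _ xj@(_ , j∈I , axj) refl B⊆B′ with i ≟F j
      ... | yes refl = refl
      ... | no i≢j   = ⊥-elim (i∉B xj (B⊆B′ (inj₂ (inj₂ (j∈I , inj₁ (axj , i≢j ∘ sym))))))

    rooted-minimal : ∀ {t A} → ValidTag t → Feasible G A → root t ∈ₛ A → A ⊆ rooted t → A ≡ rooted t
    rooted-minimal vt feasible r∈A A⊆t with rooted-inside feasible r∈A
    ... | t′ , vt′ , r′ , t′⊆A with incomparable vt′ vt r′ (A⊆t ∘ t′⊆A)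
    ...   | refl = ⊆-antisym A⊆t t′⊆A

    -- Rooted sets are paths: in A ∪ B = rooted t, the part containing the
    -- root is all of rooted t by minimality.
    rooted-isPath : ∀ {t} → ValidTag t → IsPath G (rooted t)
    rooted-isPath {t} vt = feasible-rooted vt , nonempty , notUnion
      where
      nonempty : rooted t ≢ ∅
      nonempty t≡∅ = ∉⊥ (subst (root t ∈ₛ_) t≡∅ (root∈rooted t))
      notUnion : ¬ (∃[ A ] ∃[ B ] (Feasible G A × Feasible G B × A ≢ rooted t × B ≢ rooted t × (A ∪ B) ≡ rooted t))
      notUnion (A , B , fA , fB , A≢ , B≢ , A∪B≡) with x∈p∪q⁻ A B (subst (root t ∈ₛ_) (sym A∪B≡) (root∈rooted t))
      ... | inj₁ r∈A = A≢ (rooted-minimal vt fA r∈A (subst (_ ∈ₛ_) A∪B≡ ∘ x∈p∪q⁺ ∘ inj₁))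
      ... | inj₂ r∈B = B≢ (rooted-minimal vt fB r∈B (subst (_ ∈ₛ_) A∪B≡ ∘ x∈p∪q⁺ ∘ inj₂))

    -- The root of a rooted set is the last letter of each of its shelling
    -- words: otherwise the letters before the last would form a feasible
    -- proper subset containing the root.
    root-is-last : ∀ {t pre ℓ} → ValidTag t → Valid G [] (pre ∷ʳ ℓ) →
      (∀ z → z ∈ₛ rooted t ⇔ z ∈L pre ∷ʳ ℓ) → root t ≡ ℓ
    root-is-last {t} {pre} {ℓ} vt valid listed with ∈-∷ʳ⁻ pre (to (listed (root t)) (root∈rooted t))
    ... | inj₂ r≡ℓ = r≡ℓ
    ... | inj₁ r∈pre with lastLetter pre valid
    ...   | valid-pre , (ℓ∉pre , _) = ⊥-elim (ℓ∉pre (∈-ʳ++⁺ʳ pre (∈-subsetOf⁻ (_∈? pre) ℓ∈letters)))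
      where
      pre≡t : letters pre ≡ rooted t
      pre≡t = rooted-minimal vt (feasible-letters valid-pre) (∈-subsetOf⁺ (_∈? pre) r∈pre)
        (λ z∈ → from (listed _) (∈-∷ʳ⁺ pre (inj₁ (∈-subsetOf⁻ (_∈? pre) z∈))))
      ℓ∈letters : ℓ ∈ₛ letters pre
      ℓ∈letters = subst (ℓ ∈ₛ_) (sym pre≡t) (from (listed ℓ) (∈-∷ʳ⁺ pre (inj₂ refl)))

    rooted-injective : ∀ {t t′} → ValidTag t → ValidTag t′ → rooted t ≡ rooted t′ → t ≡ t′
    rooted-injective {t} {t′} vt vt′ t≡t′ with feasible-rooted vt
    ... | w , valid , listed with initLast w
    ...   | [] = ⊥-elim (noLetter (to (listed (root t)) (root∈rooted t)))
      where
      noLetter : ∀ {z} → ¬ z ∈L []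
      noLetter ()
    ...   | pre ∷ʳ′ ℓ = incomparable vt vt′
      (trans (root-is-last vt valid listed) (sym (root-is-last vt′ valid listed′)))
      (subst (_ ∈ₛ_) t≡t′)
      where
      listed′ : ∀ z → z ∈ₛ rooted t′ ⇔ z ∈L pre ∷ʳ ℓ
      listed′ z = subst (λ S → z ∈ₛ S ⇔ z ∈L pre ∷ʳ ℓ) t≡t′ (listed z)

    -- Every path is rooted: write a shelling word of F as pre ∷ʳ ℓ; a rooted
    -- set C with root ℓ lies in F, F = C ∪ letters pre, and letters pre ≠ F.
    path-is-rooted : ∀ {F} → IsPath G F → ∃[ t ] (ValidTag t × F ≡ rooted t)
    path-is-rooted {F} ((w , valid , listed) , F≢∅ , notUnion) with initLast w
    ... | [] = ⊥-elim (F≢∅ (⊆-antisym (λ z∈F → ⊥-elim (noLetter (to (listed _) z∈F))) (⊥-elim ∘ ∉⊥)))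
      where
      noLetter : ∀ {z} → ¬ z ∈L []
      noLetter ()
    ... | pre ∷ʳ′ ℓ with lastLetter pre valid
    ...   | valid-pre , sℓ with cover valid-pre sℓ
    ...     | t , vt , refl , t⊆ = t , vt , sym (decidable-stable (≡-dec _≟B_ (rooted t) F) F-is-rooted)
      where
      t⊆F : rooted t ⊆ F
      t⊆F = from (listed _) ∘ t⊆ ∘ ∈-subsetOf⁻ (InRooted? t)
      pre≢F : letters pre ≢ F
      pre≢F pre≡F = proj₁ sℓ (∈-ʳ++⁺ʳ pre (∈-subsetOf⁻ (_∈? pre)
        (subst (root t ∈ₛ_) (sym pre≡F) (t⊆F (root∈rooted t)))))
      F-is-rooted : ¬ rooted t ≢ F
      F-is-rooted t≢F = notUnion (rooted t , letters pre , feasible-rooted vt , feasible-letters valid-pre ,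
        t≢F , pre≢F , listed-∪ listed t⊆F (root∈rooted t))

  isCrossEdge : Fin n × Fin n → Bool
  isCrossEdge p = inK (proj₁ p) ∧ not (inK (proj₂ p)) ∧ adj (proj₁ p) (proj₂ p)

  isCrossEdge⁻ : ∀ x i → T (isCrossEdge (x , i)) → CrossEdge x i
  isCrossEdge⁻ x i _ with inK x | inK i | adj x i
  ... | true | false | true = refl , refl , refl

  isCrossEdge⁺ : ∀ {x i} → CrossEdge x i → T (isCrossEdge (x , i))
  isCrossEdge⁺ (x∈K , i∈I , axi) rewrite x∈K | i∈I | axi = tt

  crossEdgeList : List (Fin n × Fin n)
  crossEdgeList = filter (λ p → T? (isCrossEdge p)) (cartesianProduct (allFin n) (allFin n))

  vertexTag : Fin n → Tag
  vertexTag x = x , nothing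

  edgeTag : Fin n × Fin n → Tag
  edgeTag p = proj₁ p , just (proj₂ p)

  tags : List Tag
  tags = map vertexTag (allFin n) ++ map edgeTag crossEdgeList

  tags-Unique : Unique tags
  tags-Unique = ++⁺ (map-Unique⁺ (cong proj₁) (allFin⁺ n))
    (map-Unique⁺ edgeTag-injective (filter⁺ _ (cartesianProduct⁺ (allFin⁺ n) (allFin⁺ n))))
    (λ (in-vertices , in-edges) → disjoint in-vertices in-edges)
    where
    edgeTag-injective : ∀ {p q} → edgeTag p ≡ edgeTag q → p ≡ q
    edgeTag-injective {x , i} {.x , .i} refl = refl
    disjoint : ∀ {t} → t ∈L map vertexTag (allFin n) → ¬ t ∈L map edgeTag crossEdgeList
    disjoint t∈V t∈E with ∈-map⁻ vertexTag t∈V | ∈-map⁻ edgeTag t∈E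
    ... | _ , _ , refl | _ , _ , ()

  tags-valid : ∀ {t} → t ∈L tags → ValidTag t
  tags-valid t∈ with ∈-++⁻ (map vertexTag (allFin n)) t∈
  ... | inj₁ t∈V with ∈-map⁻ vertexTag t∈V
  ...   | _ , _ , refl = tt
  tags-valid t∈ | inj₂ t∈E with ∈-map⁻ edgeTag t∈E
  ...   | (x , i) , p∈ , refl = isCrossEdge⁻ x i
    (proj₂ (∈-filter⁻ (λ p → T? (isCrossEdge p)) {xs = cartesianProduct (allFin n) (allFin n)} p∈))

  tags-complete : ∀ {t} → ValidTag t → t ∈L tags
  tags-complete {x , nothing} _ = ∈-++⁺ˡ (∈-map⁺ vertexTag (∈-allFin x))
  tags-complete {x , just i} xi = ∈-++⁺ʳ (map vertexTag (allFin n)) (∈-map⁺ edgeTag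
    (∈-filter⁺ (λ p → T? (isCrossEdge p)) (∈-cartesianProduct⁺ (∈-allFin x) (∈-allFin i)) (isCrossEdge⁺ xi)))

  tags-length : length tags ≡ n + crossEdges G
  tags-length = begin
    length tags                                                      ≡⟨ length-++ (map vertexTag (allFin n)) ⟩
    length (map vertexTag (allFin n)) + length (map edgeTag crossEdgeList)
      ≡⟨ cong₂ _+_ (trans (length-map vertexTag (allFin n)) (length-tabulate id)) (length-map edgeTag crossEdgeList) ⟩
    n + length crossEdgeList                                         ≡⟨ cong (n +_) (length-filter-T isCrossEdge (cartesianProduct (allFin n) (allFin n))) ⟩
    n + crossEdges G                                                 ∎
    where open ≡-Reasoning

mainTheorem11 : (n : ℕ) (G : SplitGraph n) →
    (∀ i → SplitGraph.inK G i ≡ false →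
       ¬ (∀ v → (SplitGraph.adj G i v ≡ true) ⇔ (SplitGraph.inK G v ≡ true))) →
    NumPathsIs G (n + crossEdges G)
mainTheorem11 n G noUniversal =
  map rooted tags ,
  Unique-map⁺ rooted (λ s∈ t∈ → rooted-injective (tags-valid s∈) (tags-valid t∈)) tags-Unique ,
  (λ F → mk⇔ listed⇒path path⇒listed) ,
  trans (length-map rooted tags) tags-length
  where
  open Shelling G
  open Rooted noUniversal
  listed⇒path : ∀ {F} → F ∈L map rooted tags → IsPath G F
  listed⇒path F∈ with ∈-map⁻ rooted F∈
  ... | t , t∈ , refl = rooted-isPath (tags-valid t∈)
  path⇒listed : ∀ {F} → IsPath G F → F ∈L map rooted tags
  path⇒listed isPath with path-is-rooted isPath
  ... | t , vt , refl = ∈-map⁺ rooted (tags-complete vt)
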